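{- Let $p,p'$ be coprime with $1\le p<p'$, and let $p'/p$ have continued fraction $[c_0,c_1,\ldots,c_n]$ with $n\ge1$, and if $n=1$ then $c_0>1$. If $0<\ell<2c_n-1$, then $\xi_\ell$ is interfacial in the $(p,p')$-model and neighbours the $\tilde\xi_\ell$th odd band, i.e. $\xi_\ell\in\{\lfloor \tilde\xi_\ell p'/p\rfloor,\lfloor \tilde\xi_\ell p'/p\rfloor+1\}$.
   Context: The continued fraction $[c_0,\ldots,c_n]$ of $p'/p$ has $c_i\ge1$ ($i<n$), $c_n\ge2$, $p'/p=c_0+1/(c_1+1/(\cdots+1/c_n))$. Define $y_{ -1}=0,y_0=1$, $z_{ -1}=1,z_0=0$, $y_k=c_{k-1}y_{k-1}+y_{k-2}$, $z_k=c_{k-1}z_{k-1}+z_{k-2}$ for $1\le k\le n+1$. Define $\xi_0=\tilde\xi_0=0$, $\xi_{2c_n-1}=p'$, $\tilde\xi_{2c_n-1}=p$, and for $1\le k<c_n$: $\xi_{2k-1}=ky_n$, $\xi_{2k}=ky_n+y_{n-1}$, $\tilde\xi_{2k-1}=kz_n$, $\tilde\xi_{2k}=kz_n+z_{n-1}$. In the $(p,p')$-model, for $1\le h\le p'-2$ the band between heights $h$ and $h+1$ is odd if $\lfloor hp/p'\rfloor\ne\lfloor (h+1)p/p'\rfloor$ and even otherwise; for $1\le r<p$ the $r$th odd band is the one between heights $\lfloor rp'/p\rfloor$ and $\lfloor rp'/p\rfloor+1$. For $2\le a\le p'-2$, $a$ is interfacial if $\lfloor (a+1)p/p'\rfloor=\lfloor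 (a-1)p/p'\rfloor+1$; $0$ and $p'$ are always interfacial, $1$ and $p'-1$ never. -}

module Defs where

open import Data.Nat using (ℕ; zero; suc; _+_; _*_; _∸_; _≤_; _<_; NonZero)
open import Data.Nat.DivMod using (_/_)
open import Data.Product using (_×_; _,_; proj₁; proj₂)
open import Data.Sum using (_⊎_)
open import Relation.Binary.PropositionalEquality using (_≡_)

-- A continued fraction [c 0, c 1, ..., c n] is given by a sequence c : ℕ → ℕ
-- (entries beyond index n are irrelevant).
-- cfEval c i k = (numerator , denominator) of [c i, c (i+1), ..., c (i+k)],
-- computed by folding from the back:  [c_i] = c_i / 1,
-- [c_i, rest] = c_i + 1/rest = (c_i * a + b) / a  where rest = a / b.
cfEval : (ℕ → ℕ) → ℕ → ℕ → ℕ × ℕ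
cfEval c i zero = c i , 1
cfEval c i (suc k) with cfEval c (suc i) k
... | a , b = c i * a + b , a

IsCF : ℕ → ℕ → (ℕ → ℕ) → ℕ → Set
IsCF p p' c n =
  (∀ i → i < n → 1 ≤ c i) × (2 ≤ c n) ×
  (p' * proj₂ (cfEval c 0 n) ≡ p * proj₁ (cfEval c 0 n))

-- Shifted indices: Y j = y_{j-1}, Z j = z_{j-1}  (so y_{-1} = Y 0, y_0 = Y 1, ...).
Y : (ℕ → ℕ) → ℕ → ℕ
Y c zero = 0
Y c (suc zero) = 1
Y c (suc (suc j)) = c j * Y c (suc j) + Y c j

Z : (ℕ → ℕ) → ℕ → ℕ
Z c zero = 1
Z c (suc zero) = 0
Z c (suc (suc j)) = c j * Z c (suc j) + Z c j

body : ℕ → ℕ → ℕ → ℕ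
body u v zero = 0
body u v (suc zero) = u
body u v (suc (suc zero)) = u + v
body u v (suc (suc (suc ℓ))) = u + body u v (suc ℓ)

-- ξ_ℓ and ξ̃_ℓ for 0 ≤ ℓ < 2 c_n - 1 (u = y_n = Y (n+1), v = y_{n-1} = Y n);
-- the value ξ_{2c_n - 1} = p' (resp. p) is not needed here.
ξ : (ℕ → ℕ) → ℕ → ℕ → ℕ
ξ c n ℓ = body (Y c (suc n)) (Y c n) ℓ

ξ̃ : (ℕ → ℕ) → ℕ → ℕ → ℕ
ξ̃ c n ℓ = body (Z c (suc n)) (Z c n) ℓ

Interfacial : (p p' : ℕ) .{{_ : NonZero p'}} → ℕ → Set
Interfacial p p' a =
  a ≡ 0 ⊎ a ≡ p' ⊎
  (2 ≤ a × a + 2 ≤ p' × (suc a * p) / p' ≡ suc (((a ∸ 1) * p) / p'))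

NeighboursOddBand : (p p' : ℕ) .{{_ : NonZero p}} → ℕ → ℕ → Set
NeighboursOddBand p p' r a = a ≡ (r * p') / p ⊎ a ≡ suc ((r * p') / p)

{-# OPTIONS --safe #-}
-- Put u = y_n, v = y_{n-1}, U = z_n, V = z_{n-1}.  The continuants y_{n+1} = c_n u + v and
-- z_{n+1} = c_n U + V have ratio p'/p and are coprime because uV - vU = ±1, so they are p' and p.
-- For ℓ = 2K - 1 the pair (a, r) = (ξ_ℓ, ξ̃_ℓ) = (Ku, KU) has ap - rp' = K(uV - vU) = ±K, and for
-- ℓ = 2K the pair (Ku + v, KU + V) has ap - rp' = ∓(c_n - K).  So in both cases |ap - rp'| = m
-- with 0 < m < c_n ≤ p and m + p < p', and this forces ⌊(a+1)p/p'⌋ = r = ⌊(a-1)p/p'⌋ + 1 and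
-- ⌊rp'/p⌋ ∈ {a - 1, a}.
module Submission where

open import Defs
open import Data.Nat
open import Data.Nat.Properties
open import Data.Nat.DivMod
open import Data.Nat.Divisibility
open import Data.Nat.Coprimality using (Coprime; coprime-divisor)
import Data.Nat.Coprimality as Coprimality
open import Data.Nat.Tactic.RingSolver using (solve-∀)
open import Data.Product using (_×_; _,_; ∃-syntax)
open import Data.Sum using (_⊎_; inj₁; inj₂)
open import Function using (_∘_)
open import Relation.Binary.PropositionalEquality
  using (_≡_; refl; sym; trans; cong; cong₂; subst; subst₂; module ≡-Reasoning)
open import Relation.Nullary using (contradiction)

data DifferBy (m x y : ℕ) : Set where
  below : x + m ≡ y → DifferBy m x y
  above : y + m ≡ x → DifferBy m x y

DifferBy-sym : ∀ {m x y} → DifferBy m x y → DifferBy m y x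
DifferBy-sym (below eq) = above eq
DifferBy-sym (above eq) = below eq

DifferBy-+ˡ : ∀ {m x y} w → DifferBy m x y → DifferBy m (w + x) (w + y)
DifferBy-+ˡ {m} {x} {y} w (below eq) = below (trans (+-assoc w x m) (cong (w +_) eq))
DifferBy-+ˡ {m} {x} {y} w (above eq) = above (trans (+-assoc w y m) (cong (w +_) eq))

x+w+w*t≡x+w*[t+1] : ∀ x w t → x + w + w * t ≡ x + w * (t + 1)
x+w+w*t≡x+w*[t+1] = solve-∀

DifferBy-cancel : ∀ {s t w X Y} → DifferBy 1 t s → X + w * s ≡ Y + w * t → DifferBy w X Y
DifferBy-cancel {w = w} {X} {Y} (below refl) eq =
  below (+-cancelʳ-≡ _ (X + w) Y (trans (x+w+w*t≡x+w*[t+1] X w _) eq))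
DifferBy-cancel {w = w} {X} {Y} (above refl) eq =
  above (+-cancelʳ-≡ _ (Y + w) X (trans (x+w+w*t≡x+w*[t+1] Y w _) (sym eq)))

DifferBy-1⇒∣1 : ∀ {d x y} → d ∣ x → d ∣ y → DifferBy 1 x y → d ∣ 1
DifferBy-1⇒∣1 d∣x d∣y (below eq) = ∣m+n∣m⇒∣n (subst (_ ∣_) (sym eq) d∣y) d∣x
DifferBy-1⇒∣1 d∣x d∣y (above eq) = ∣m+n∣m⇒∣n (subst (_ ∣_) (sym eq) d∣x) d∣y

DifferBy-1⇒Coprime : ∀ {m n x y} → DifferBy 1 (m * x) (y * n) → Coprime m n
DifferBy-1⇒Coprime {x = x} {y} δ (d∣m , d∣n) =
  ∣1⇒≡1 (DifferBy-1⇒∣1 (∣m⇒∣m*n x d∣m) (∣n⇒∣m*n y d∣n) δ)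

reduced-fraction-unique : ∀ {a b c d} → Coprime a b → Coprime c d →
  a * d ≡ b * c → a ≡ c × b ≡ d
reduced-fraction-unique {a} {b} {c} {d} a⊥b c⊥d eq =
  ∣-antisym (coprime-divisor a⊥b a∣b*c) (coprime-divisor c⊥d c∣d*a) ,
  ∣-antisym (coprime-divisor (Coprimality.sym a⊥b) b∣a*d)
            (coprime-divisor (Coprimality.sym c⊥d) d∣c*b)
  where
  a∣b*c : a ∣ b * c
  a∣b*c = subst (a ∣_) eq (m∣m*n d)
  c∣d*a : c ∣ d * a
  c∣d*a = subst (c ∣_) (trans (*-comm c b) (trans (sym eq) (*-comm a d))) (m∣m*n b)
  b∣a*d : b ∣ a * d
  b∣a*d = subst (b ∣_) (sym eq) (m∣m*n c)
  d∣c*b : d ∣ c * b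
  d∣c*b = subst (d ∣_) (trans (*-comm d a) (trans eq (*-comm b c))) (m∣m*n a)

quotient-from-bounds : ∀ {x d q} .{{_ : NonZero d}} → q * d ≤ x → x < suc q * d → x / d ≡ q
quotient-from-bounds {x} {d} {q} lower upper = ≤-antisym
  (s≤s⁻¹ (m<n*o⇒m/o<n upper))
  (subst (_≤ x / d) (m*n/n≡m q d) (/-monoˡ-≤ d lower))

-- x plays the role of (a - 1) p, so that a p = p + x and (a + 1) p = p + (p + x).
module _ {p p' m : ℕ} .{{_ : NonZero p'}} (m<p : m < p) (m+p<p' : m + p < p') where

  private
    p<p' : p < p'
    p<p' = ≤-<-trans (m≤n+m p m) m+p<p'

  [p+[p+x]]/p'≡r : ∀ {x r} → DifferBy m (p + x) (r * p') → (p + (p + x)) / p' ≡ r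
  [p+[p+x]]/p'≡r {x} {r} (below eq) = quotient-from-bounds
    (begin
      r * p'        ≡⟨ eq ⟨
      p + x + m     ≤⟨ +-monoʳ-≤ (p + x) (<⇒≤ m<p) ⟩
      p + x + p     ≡⟨ +-comm (p + x) p ⟩
      p + (p + x)   ∎)
    (begin-strict
      p + (p + x)       ≤⟨ +-monoʳ-≤ p (m≤m+n (p + x) m) ⟩
      p + (p + x + m)   ≡⟨ cong (p +_) eq ⟩
      p + r * p'        <⟨ +-monoˡ-< (r * p') p<p' ⟩
      p' + r * p'       ∎)
    where open ≤-Reasoning
  [p+[p+x]]/p'≡r {x} {r} (above eq) = quotient-from-bounds
    (begin
      r * p'        ≤⟨ m≤m+n (r * p') m ⟩
      r * p' + m    ≡⟨ eq ⟩
      p + x         ≤⟨ m≤n+m (p + x) p ⟩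
      p + (p + x)   ∎)
    (begin-strict
      p + (p + x)         ≡⟨ cong (p +_) eq ⟨
      p + (r * p' + m)    ≡⟨ rearrange p (r * p') m ⟩
      m + p + r * p'      <⟨ +-monoˡ-< (r * p') m+p<p' ⟩
      p' + r * p'         ∎)
    where
    open ≤-Reasoning
    rearrange : ∀ p e m → p + (e + m) ≡ m + p + e
    rearrange = solve-∀

  [x+p']/p'≡r : ∀ {x r} → DifferBy m (p + x) (r * p') → (x + p') / p' ≡ r
  [x+p']/p'≡r {x} {r} δ = quotient-from-bounds (lower δ)
    (begin-strict
      x + p'        ≡⟨ +-comm x p' ⟩
      p' + x        <⟨ +-monoʳ-< p' (upper δ) ⟩
      p' + r * p'   ∎)
    where
    open ≤-Reasoning
    lower : DifferBy m (p + x) (r * p') → r * p' ≤ x + p'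
    lower (below eq) = begin
      r * p'        ≡⟨ eq ⟨
      p + x + m     ≡⟨ rearrange p x m ⟩
      x + (m + p)   ≤⟨ +-monoʳ-≤ x (<⇒≤ m+p<p') ⟩
      x + p'        ∎
      where
      rearrange : ∀ p x m → p + x + m ≡ x + (m + p)
      rearrange = solve-∀
    lower (above eq) = begin
      r * p'        ≤⟨ m≤m+n (r * p') m ⟩
      r * p' + m    ≡⟨ eq ⟩
      p + x         ≤⟨ +-monoˡ-≤ x (<⇒≤ p<p') ⟩
      p' + x        ≡⟨ +-comm p' x ⟩
      x + p'        ∎
    upper : DifferBy m (p + x) (r * p') → x < r * p'
    upper (below eq) = begin-strict
      x             <⟨ m<n+m x (≤-<-trans z≤n m<p) ⟩
      p + x         ≤⟨ m≤m+n (p + x) m ⟩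
      p + x + m     ≡⟨ eq ⟩
      r * p'        ∎
    upper (above eq) = +-cancelʳ-< p x (r * p') (begin-strict
      x + p         ≡⟨ +-comm x p ⟩
      p + x         ≡⟨ eq ⟨
      r * p' + m    <⟨ +-monoʳ-< (r * p') m<p ⟩
      r * p' + p    ∎)

DifferBy⇒Interfacial : ∀ {p p' m} .{{_ : NonZero p'}} a r → m < p → m + p < p' →
  2 ≤ a → a + 2 ≤ p' → DifferBy m (a * p) (r * p') → Interfacial p p' a
DifferBy⇒Interfacial {p} {p'} (suc a₀) r m<p m+p<p' 2≤a a+2≤p' δ =
  inj₂ (inj₂ (2≤a , a+2≤p' , (begin
    suc (suc a₀) * p / p'         ≡⟨ [p+[p+x]]/p'≡r m<p m+p<p' δ ⟩
    r                             ≡⟨ [x+p']/p'≡r m<p m+p<p' δ ⟨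
    (a₀ * p + p') / p'            ≡⟨ +-distrib-/-∣ʳ (a₀ * p) ∣-refl ⟩
    a₀ * p / p' + p' / p'         ≡⟨ cong (a₀ * p / p' +_) (n/n≡1 p') ⟩
    a₀ * p / p' + 1               ≡⟨ +-comm (a₀ * p / p') 1 ⟩
    suc (a₀ * p / p')             ∎)))
  where open ≡-Reasoning

DifferBy⇒NeighboursOddBand : ∀ {p p' m} .{{_ : NonZero p}} a r → 1 ≤ m → m < p →
  DifferBy m (a * p) (r * p') → NeighboursOddBand p p' r a
DifferBy⇒NeighboursOddBand {p} {p'} {m} a r 1≤m m<p (below eq) =
  inj₁ (sym (quotient-from-bounds
    (begin
      a * p         ≤⟨ m≤m+n (a * p) m ⟩
      a * p + m     ≡⟨ eq ⟩
      r * p'        ∎)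
    (begin-strict
      r * p'        ≡⟨ eq ⟨
      a * p + m     <⟨ +-monoʳ-< (a * p) m<p ⟩
      a * p + p     ≡⟨ +-comm (a * p) p ⟩
      p + a * p     ∎)))
  where open ≤-Reasoning
DifferBy⇒NeighboursOddBand {p' = p'} zero r (s≤s _) _ (above eq) =
  contradiction eq (m+1+n≢0 (r * p'))
DifferBy⇒NeighboursOddBand {p} {p'} {m} (suc a₀) r 1≤m m<p (above eq) =
  inj₂ (cong suc (sym (quotient-from-bounds
    (+-cancelʳ-≤ p (a₀ * p) (r * p') (begin
      a₀ * p + p    ≡⟨ +-comm (a₀ * p) p ⟩
      p + a₀ * p    ≡⟨ eq ⟨
      r * p' + m    ≤⟨ +-monoʳ-≤ (r * p') (<⇒≤ m<p) ⟩
      r * p' + p    ∎))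
    (begin-strict
      r * p'        <⟨ m<m+n (r * p') 1≤m ⟩
      r * p' + m    ≡⟨ eq ⟩
      p + a₀ * p    ∎))))
  where open ≤-Reasoning

cfEval-shift : ∀ c i k → cfEval c (suc i) k ≡ cfEval (c ∘ suc) i k
cfEval-shift c i zero = refl
cfEval-shift c i (suc k) =
  cong (λ (a , b) → c (suc i) * a + b , a) (cfEval-shift c (suc i) k)

Y-two : ∀ c → Y c 2 ≡ c 0
Y-two c = trans (+-identityʳ (c 0 * 1)) (*-identityʳ (c 0))

Z-two : ∀ c → Z c 2 ≡ 1
Z-two c = cong (_+ 1) (*-zeroʳ (c 0))

Y-prepend : ∀ c j → Y c (suc j) ≡ c 0 * Y (c ∘ suc) j + Z (c ∘ suc) j
Y-prepend c zero = cong (_+ 1) (sym (*-zeroʳ (c 0)))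
Y-prepend c (suc zero) = refl
Y-prepend c (suc (suc j)) = begin
  c (suc j) * Y c (suc (suc j)) + Y c (suc j)
    ≡⟨ cong₂ (λ y y' → c (suc j) * y + y') (Y-prepend c (suc j)) (Y-prepend c j) ⟩
  c (suc j) * (c 0 * Y c' (suc j) + Z c' (suc j)) + (c 0 * Y c' j + Z c' j)
    ≡⟨ regroup (c 0) (c (suc j)) (Y c' (suc j)) (Z c' (suc j)) (Y c' j) (Z c' j) ⟩
  c 0 * Y c' (suc (suc j)) + Z c' (suc (suc j))
    ∎
  where
  open ≡-Reasoning
  c' = c ∘ suc
  regroup : ∀ a b y₁ z₁ y₀ z₀ →
    b * (a * y₁ + z₁) + (a * y₀ + z₀) ≡ a * (b * y₁ + y₀) + (b * z₁ + z₀)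
  regroup = solve-∀

Z-prepend : ∀ c j → Z c (suc j) ≡ Y (c ∘ suc) j
Z-prepend c zero = refl
Z-prepend c (suc zero) = Z-two c
Z-prepend c (suc (suc j)) =
  cong₂ (λ z z' → c (suc j) * z + z') (Z-prepend c (suc j)) (Z-prepend c j)

cfEval≡continuants : ∀ c k → cfEval c 0 k ≡ (Y c (2 + k) , Z c (2 + k))
cfEval≡continuants c zero = sym (cong₂ _,_ (Y-two c) (Z-two c))
cfEval≡continuants c (suc k) = begin
  cfEval c 0 (suc k)
    ≡⟨ cong (λ (a , b) → c 0 * a + b , a)
            (trans (cfEval-shift c 0 k) (cfEval≡continuants (c ∘ suc) k)) ⟩
  (c 0 * Y (c ∘ suc) (2 + k) + Z (c ∘ suc) (2 + k) , Y (c ∘ suc) (2 + k))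
    ≡⟨ cong₂ _,_ (Y-prepend c (2 + k)) (Z-prepend c (2 + k)) ⟨
  (Y c (3 + k) , Z c (3 + k))
    ∎
  where open ≡-Reasoning

Y-Z-determinant : ∀ c j → DifferBy 1 (Y c (suc j) * Z c j) (Y c j * Z c (suc j))
Y-Z-determinant c zero = above refl
Y-Z-determinant c (suc j) =
  subst₂ (DifferBy 1)
    (sym (expandˡ (c j) (Y c (suc j)) (Y c j) (Z c (suc j))))
    (sym (expandʳ (c j) (Y c (suc j)) (Z c (suc j)) (Z c j)))
    (DifferBy-+ˡ (c j * Y c (suc j) * Z c (suc j)) (DifferBy-sym (Y-Z-determinant c j)))
  where
  expandˡ : ∀ a y₁ y₀ z₁ → (a * y₁ + y₀) * z₁ ≡ a * y₁ * z₁ + y₀ * z₁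
  expandˡ = solve-∀
  expandʳ : ∀ a y₁ z₁ z₀ → y₁ * (a * z₁ + z₀) ≡ a * y₁ * z₁ + y₁ * z₀
  expandʳ = solve-∀

Y-Z-coprime : ∀ c j → Coprime (Y c (suc j)) (Z c (suc j))
Y-Z-coprime c j = DifferBy-1⇒Coprime {x = Z c j} {Y c j} (Y-Z-determinant c j)

Z-positive : ∀ c j → (∀ i → i < suc j → 1 ≤ c i) → 1 ≤ Z c (2 + j)
Z-positive c zero _ = ≤-reflexive (sym (Z-two c))
Z-positive c (suc j) c-pos = ≤-trans
  (*-mono-≤ (c-pos (suc j) ≤-refl) (Z-positive c j (λ i i<1+j → c-pos i (m<n⇒m<1+n i<1+j))))
  (m≤m+n (c (suc j) * Z c (2 + j)) (Z c (suc j)))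

Z≤Y : ∀ c → 1 ≤ c 0 → ∀ j → Z c (suc j) ≤ Y c (suc j)
Z≤Y c _ zero = z≤n
Z≤Y c 1≤c₀ (suc zero) = subst₂ _≤_ (sym (Z-two c)) (sym (Y-two c)) 1≤c₀
Z≤Y c 1≤c₀ (suc (suc j)) =
  +-mono-≤ (*-monoʳ-≤ (c (suc j)) (Z≤Y c 1≤c₀ (suc j))) (Z≤Y c 1≤c₀ j)

Z<Y : ∀ c j → (∀ i → i < 2 + j → 1 ≤ c i) → Z c (3 + j) < Y c (3 + j)
Z<Y c zero c-pos = +-mono-≤-< (*-monoʳ-≤ (c 1) (Z≤Y c (c-pos 0 z<s) 1)) z<s
Z<Y c (suc j) c-pos =
  +-mono-<-≤ (*-monoʳ-< (c (2 + j)) ⦃ >-nonZero (c-pos (2 + j) ≤-refl) ⦄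
                (Z<Y c j (λ i i<2+j → c-pos i (m<n⇒m<1+n i<2+j))))
             (Z≤Y c (c-pos 0 z<s) (suc j))

continuant-bounds : ∀ c n → (∀ i → i < n → 1 ≤ c i) → 1 ≤ n → (n ≡ 1 → 1 < c 0) →
  1 ≤ Z c (suc n) × Z c (suc n) < Y c (suc n) × Z c n ≤ Y c n
continuant-bounds c (suc zero) c-pos _ 1<c₀ =
  Z-positive c 0 c-pos , subst₂ _<_ (sym (Z-two c)) (sym (Y-two c)) (1<c₀ refl) , z≤n
continuant-bounds c (suc (suc j)) c-pos _ _ =
  Z-positive c (suc j) c-pos , Z<Y c j c-pos , Z≤Y c (c-pos 0 z<s) (suc j)

odd-or-even : ∀ n → ∃[ k ] (n ≡ k + k ⊎ n ≡ suc (k + k))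
odd-or-even zero = 0 , inj₁ refl
odd-or-even (suc n) with odd-or-even n
... | k , inj₁ refl = k , inj₂ refl
... | k , inj₂ refl = suc k , inj₁ (cong suc (sym (+-suc k k)))

body-odd : ∀ u v k → body u v (suc (k + k)) ≡ suc k * u
body-odd u v zero = sym (+-identityʳ u)
body-odd u v (suc k) rewrite +-suc k k = cong (u +_) (body-odd u v k)

body-even : ∀ u v k → body u v (suc (suc (k + k))) ≡ suc k * u + v
body-even u v zero = cong (_+ v) (sym (+-identityʳ u))
body-even u v (suc k) rewrite +-suc k k =
  trans (cong (u +_) (body-even u v k)) (sym (+-assoc u (suc k * u) v))

half-bound : ∀ k c → suc (k + k) < 2 * c ∸ 1 → suc k < c
half-bound k zero ()
half-bound k (suc c) h = *-cancelˡ-< 2 (suc k) (suc c)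
  (subst (_≤ 2 * suc c) (double k) (m≤o∸n⇒m+n≤o (suc (suc (k + k))) z<s h))
  where
  double : ∀ k → suc (suc (k + k)) + 1 ≡ suc (2 * suc k)
  double = solve-∀

module _ {p p' u v U V cₙ : ℕ} .{{_ : NonZero p}} .{{_ : NonZero p'}}
  (p'≡ : p' ≡ cₙ * u + v) (p≡ : p ≡ cₙ * U + V) (det : DifferBy 1 (u * V) (v * U))
  (1≤U : 1 ≤ U) (U<u : U < u) (V≤v : V ≤ v) where

  private
    cₙ≤p : cₙ ≤ p
    cₙ≤p = begin
      cₙ          ≤⟨ m≤m*n cₙ U ⦃ >-nonZero 1≤U ⦄ ⟩
      cₙ * U      ≤⟨ m≤m+n (cₙ * U) V ⟩
      cₙ * U + V  ≡⟨ p≡ ⟨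
      p           ∎
      where open ≤-Reasoning

    gap : ∀ {m} → m < cₙ → m + p < p'
    gap {m} m<cₙ = begin-strict
      m + p                 <⟨ +-monoˡ-< p m<cₙ ⟩
      cₙ + p                ≡⟨ cong (cₙ +_) p≡ ⟩
      cₙ + (cₙ * U + V)     ≡⟨ +-assoc cₙ (cₙ * U) V ⟨
      cₙ + cₙ * U + V       ≡⟨ cong (_+ V) (*-suc cₙ U) ⟨
      cₙ * suc U + V        ≤⟨ +-mono-≤ (*-monoʳ-≤ cₙ U<u) V≤v ⟩
      cₙ * u + v            ≡⟨ p'≡ ⟨
      p'                    ∎
      where open ≤-Reasoning

    2≤u : 2 ≤ u
    2≤u = ≤-<-trans 1≤U U<u

    2≤K*u : ∀ {K} → 1 ≤ K → 2 ≤ K * u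
    2≤K*u {K} 1≤K = ≤-trans 2≤u (m≤n*m u K ⦃ >-nonZero 1≤K ⦄)

    K*u+v+2≤p' : ∀ {K} → K < cₙ → K * u + v + 2 ≤ p'
    K*u+v+2≤p' {K} K<cₙ = begin
      K * u + v + 2         ≤⟨ +-monoʳ-≤ (K * u + v) 2≤u ⟩
      K * u + v + u         ≡⟨ rearrange K u v ⟩
      suc K * u + v         ≤⟨ +-monoˡ-≤ v (*-monoˡ-≤ u K<cₙ) ⟩
      cₙ * u + v            ≡⟨ p'≡ ⟨
      p'                    ∎
      where
      open ≤-Reasoning
      rearrange : ∀ K u v → K * u + v + u ≡ suc K * u + v
      rearrange = solve-∀

  odd-point : ∀ K → 1 ≤ K → K < cₙ →
    Interfacial p p' (K * u) × NeighboursOddBand p p' (K * U) (K * u)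
  odd-point K 1≤K K<cₙ =
    DifferBy⇒Interfacial (K * u) (K * U) K<p (gap K<cₙ) (2≤K*u 1≤K)
      (≤-trans (+-monoˡ-≤ 2 (m≤m+n (K * u) v)) (K*u+v+2≤p' K<cₙ)) δ ,
    DifferBy⇒NeighboursOddBand (K * u) (K * U) 1≤K K<p δ
    where
    K<p = <-≤-trans K<cₙ cₙ≤p
    identity : ∀ K c u v U V →
      K * u * (c * U + V) + K * (v * U) ≡ K * U * (c * u + v) + K * (u * V)
    identity = solve-∀
    δ : DifferBy K (K * u * p) (K * U * p')
    δ = subst₂ (DifferBy K) (cong (K * u *_) (sym p≡)) (cong (K * U *_) (sym p'≡))
          (DifferBy-cancel det (identity K cₙ u v U V))

  even-point : ∀ K → 1 ≤ K → K < cₙ →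
    Interfacial p p' (K * u + v) × NeighboursOddBand p p' (K * U + V) (K * u + v)
  even-point K 1≤K K<cₙ =
    DifferBy⇒Interfacial (K * u + v) (K * U + V) J<p (gap J<cₙ)
      (≤-trans (2≤K*u 1≤K) (m≤m+n (K * u) v)) (K*u+v+2≤p' K<cₙ) δ ,
    DifferBy⇒NeighboursOddBand (K * u + v) (K * U + V) (m<n⇒0<n∸m K<cₙ) J<p δ
    where
    J = cₙ ∸ K
    J<cₙ : J < cₙ
    J<cₙ = ∸-monoʳ-< 1≤K (<⇒≤ K<cₙ)
    J<p = <-≤-trans J<cₙ cₙ≤p
    K+J≡cₙ : K + J ≡ cₙ
    K+J≡cₙ = m+[n∸m]≡n (<⇒≤ K<cₙ)
    identity : ∀ K J u v U V →
      (K * u + v) * ((K + J) * U + V) + J * (u * V) ≡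
      (K * U + V) * ((K + J) * u + v) + J * (v * U)
    identity = solve-∀
    δ : DifferBy J ((K * u + v) * p) ((K * U + V) * p')
    δ = subst₂ (DifferBy J)
          (cong ((K * u + v) *_) (trans (cong (λ c → c * U + V) K+J≡cₙ) (sym p≡)))
          (cong ((K * U + V) *_) (trans (cong (λ c → c * u + v) K+J≡cₙ) (sym p'≡)))
          (DifferBy-cancel (DifferBy-sym det) (identity K J u v U V))

  body-interfacial : ∀ ℓ → 0 < ℓ → ℓ < 2 * cₙ ∸ 1 →
    Interfacial p p' (body u v ℓ) × NeighboursOddBand p p' (body U V ℓ) (body u v ℓ)
  body-interfacial (suc ℓ) _ ℓ< with odd-or-even ℓ
  ... | k , inj₁ refl rewrite body-odd u v k | body-odd U V k =
    odd-point (suc k) z<s (half-bound k cₙ ℓ<)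
  ... | k , inj₂ refl rewrite body-even u v k | body-even U V k =
    even-point (suc k) z<s (half-bound k cₙ (<-trans (n<1+n _) ℓ<))

theoremE10 : (p p' : ℕ) .{{_ : NonZero p}} .{{_ : NonZero p'}} →
    Coprime p p' → 1 ≤ p → p < p' →
    (c : ℕ → ℕ) (n : ℕ) → IsCF p p' c n → 1 ≤ n → (n ≡ 1 → 1 < c 0) →
    (ℓ : ℕ) → 0 < ℓ → ℓ < 2 * c n ∸ 1 →
    Interfacial p p' (ξ c n ℓ) × NeighboursOddBand p p' (ξ̃ c n ℓ) (ξ c n ℓ)
theoremE10 p p' coprime _ _ c n (c-pos , _ , value) 1≤n n≡1⇒1<c₀
  with p'≡Y , p≡Z ← reduced-fraction-unique (Coprimality.sym coprime) (Y-Z-coprime c (suc n))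
                      (subst (λ (y , z) → p' * z ≡ p * y) (cfEval≡continuants c n) value)
     | 1≤U , U<u , V≤v ← continuant-bounds c n c-pos 1≤n n≡1⇒1<c₀
  = body-interfacial {cₙ = c n} p'≡Y p≡Z (Y-Z-determinant c n) 1≤U U<u V≤v
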